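{- Suppose $(\mathsf P,\mathsf{Opens})$ is a semitopology and suppose $p,p'\in\mathsf P$ are regular. Then $$ K(p)\between K(p') \quad\Longleftrightarrow\quad K(p)=K(p'). $$
   Context: A semitopology is a pair $(\mathsf P,\mathsf{Opens})$ with $\mathsf{Opens}\subseteq\mathcal P(\mathsf P)$ containing $\varnothing$ and $\mathsf P$ and closed under arbitrary unions. For sets $X,Y$ write $X\between Y$ when $X\cap Y\neq\varnothing$. A set $T$ is topen when it is nonempty, open and transitive (for all open $O,O'$, $O\between T\between O'$ implies $O\between O'$); $\mathsf{Topen}$ is the set of topens. Points $p,p'$ are intertwined when every open neighbourhood of $p$ intersects every open neighbourhood of $p'$; $p_{\between}$ denotes the set of points intertwined with $p$. $\mathrm{interior}(X)$ is the union of open sets contained in $X$. The community of $p$ is $K(p)=\mathrm{interior}(p_{\between})$, and $p$ is regular when $p\in K(p)\in\mathsf{Topen}$. -}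

module Defs where

open import Level using (Level; _⊔_; suc; zero)
open import Data.Product using (Σ; ∃; _×_; _,_)
open import Data.Empty using (⊥)
open import Data.Unit using (⊤)

module _ {P : Set} where

  _⊆_ : ∀ {a b} → (P → Set a) → (P → Set b) → Set (a ⊔ b)
  X ⊆ Y = ∀ p → X p → Y p

  _≐_ : ∀ {a b} → (P → Set a) → (P → Set b) → Set (a ⊔ b)
  X ≐ Y = (X ⊆ Y) × (Y ⊆ X)

  -- X ≬ Y  means  X ∩ Y ≠ ∅ (constructively: they share a point)
  _≬_ : ∀ {a b} → (P → Set a) → (P → Set b) → Set (a ⊔ b)
  X ≬ Y = ∃ λ p → X p × Y p

record Semitopology (P : Set) : Set₂ where
  field
    Open      : (P → Set) → Set₁
    open-∅    : Open (λ _ → ⊥)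
    open-full : Open (λ _ → ⊤)
    open-⋃    : (I : Set) (O : I → P → Set) → (∀ i → Open (O i)) →
                Open (λ p → Σ I λ i → O i p)

module _ {P : Set} (S : Semitopology P) where
  open Semitopology S

  -- a subset (of any universe level) is open if it is (extensionally) equal to an open set
  IsOpen : ∀ {a} → (P → Set a) → Set (suc zero ⊔ a)
  IsOpen X = Σ (P → Set) λ O → Open O × (X ≐ O)

  Transitive : ∀ {a} → (P → Set a) → Set (suc zero ⊔ a)
  Transitive T = ∀ (O O' : P → Set) → Open O → Open O' → O ≬ T → T ≬ O' → O ≬ O'

  Topen : ∀ {a} → (P → Set a) → Set (suc zero ⊔ a)
  Topen T = (∃ λ p → T p) × IsOpen T × Transitive T

  Intertwined : P → P → Set₁
  Intertwined p p' = ∀ (O O' : P → Set) → Open O → Open O' → O p → O' p' → O ≬ O'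

  intertwinedWith : P → P → Set₁
  intertwinedWith p = Intertwined p

  interior : ∀ {a} → (P → Set a) → P → Set (suc zero ⊔ a)
  interior X q = Σ (P → Set) λ O → Open O × (O ⊆ X) × O q

  K : P → P → Set₁
  K p = interior (intertwinedWith p)

  Regular : P → Set₁
  Regular p = K p p × Topen (K p)

-- Transitivity of T lets an open set meeting T pass on to any open set T meets, and it
-- makes any two points of T intertwined. Chaining these through two meeting topens, if
-- K(p) and K(p') meet then every point of K(p) is intertwined with p', so the open set K(p)
-- lies in p'_≬ and thus in its interior K(p'); by symmetry K(p) = K(p').
module Submission where

open import Defs
open import Level using (Level)
open import Data.Product using (_,_; proj₁)
open import Function.Bundles using (_⇔_; mk⇔)

≬-sym : {P : Set} {a b : Level} {X : P → Set a} {Y : P → Set b} → X ≬ Y → Y ≬ X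
≬-sym (z , x , y) = z , y , x

module _ {P : Set} (S : Semitopology P) where
  open Semitopology S

  private
    variable
      a b : Level

  transitive-≬-open : {T : P → Set a} {T' : P → Set b} →
                      Transitive S T → IsOpen S T' →
                      ∀ {U} → Open U → U ≬ T → T ≬ T' → U ≬ T'
  transitive-≬-open trT (O' , oO' , T'⊆O' , O'⊆T') oU U≬T (z , Tz , T'z)
    with trT _ O' oU oO' U≬T (z , Tz , T'⊆O' z T'z)
  ... | y , Uy , O'y = y , Uy , O'⊆T' y O'y

  intertwined-across : {T : P → Set a} {T' : P → Set b} →
                       Transitive S T → Transitive S T' → IsOpen S T' → T ≬ T' →
                       ∀ {x y} → T x → T' y → Intertwined S x y
  intertwined-across trT trT' openT' T≬T' {x} {y} Tx T'y U V oU oV Ux Vy =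
    trT' U V oU oV (transitive-≬-open trT openT' oU (x , Ux , Tx) T≬T') (y , T'y , Vy)

  open⊆interior : {X : P → Set a} {Y : P → Set b} → IsOpen S X → X ⊆ Y → X ⊆ interior S Y
  open⊆interior (O , oO , X⊆O , O⊆X) X⊆Y q Xq =
    O , oO , (λ r Or → X⊆Y r (O⊆X r Or)) , X⊆O q Xq

  community-⊆ : ∀ {p p'} → Regular S p → Regular S p' → K S p ≬ K S p' → K S p ⊆ K S p'
  community-⊆ (_ , _ , openKp , trKp) (p'∈Kp' , _ , _ , trKp') Kp≬Kp' =
    open⊆interior openKp λ _ x∈Kp →
      intertwined-across trKp' trKp openKp (≬-sym Kp≬Kp') p'∈Kp' x∈Kp

proposition4p24 : {P : Set} (S : Semitopology P) (p p' : P) →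
    Regular S p → Regular S p' →
    (K S p ≬ K S p') ⇔ (K S p ≐ K S p')
proposition4p24 S p p' r r' = mk⇔
  (λ Kp≬Kp' → community-⊆ S r r' Kp≬Kp' , community-⊆ S r' r (≬-sym Kp≬Kp'))
  (λ Kp≐Kp' → p , proj₁ r , proj₁ Kp≐Kp' p (proj₁ r))
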